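{- Let $t$ and $n$ be integers with $1\leq t\leq n$ and let $L=\{1^{a_1},2^{a_2},\ldots,t^{a_t}\}$ with $a_i\geq 0$ and $|L|=a_1+\cdots+a_t=n$. Set $R=\sum_{j\geq 1}a_{2j}$ and $S=\sum_{j\geq 2}\left\lfloor\frac{j-1}{2}\right\rfloor a_j$ (with $a_j=0$ for $j>t$). If $R$ is even and $a_1\geq S$, then there exists a perfect matching $F$ of $K_{2n}$ such that $\ell(F)=L$.
   Context: For a positive integer $v$, $K_v$ denotes the complete graph on the vertex set $\{0,1,\ldots,v-1\}$. The length of an edge $\{u,w\}$ of $K_v$ is $\ell(u,w)=\min(|u-w|,\,v-|u-w|)$. For a subgraph $\Gamma$ of $K_v$, $\ell(\Gamma)$ is the list (multiset) of lengths of all edges of $\Gamma$, counted with multiplicity. A perfect matching of $K_{2n}$ is a set of $n$ pairwise disjoint edges covering all vertices. The notation $\{1^{a_1},\ldots,t^{a_t}\}$ denotes the list containing $a_i$ copies of $i$ for each $i$. -}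

module Defs where

open import Data.Nat using (ℕ; zero; suc; _+_; _*_; _∸_; _⊓_; ∣_-_∣; _/_; _%_)
open import Data.Nat.Properties using ()
open import Data.Fin using (Fin; toℕ)
open import Data.List using (List; []; _∷_; map; concatMap; replicate; allFin)
open import Data.Nat.ListAction using (sum)
open import Data.Unit using (⊤)
open import Data.Fin using (fromℕ<)
open import Data.Nat using (_<?_)
open import Relation.Nullary using (yes; no)
open import Data.Product using (_×_; _,_)
open import Data.List.Relation.Binary.Permutation.Propositional using (_↭_)
open import Relation.Binary.PropositionalEquality using (_≢_)

-- Vertices of K_v are Fin v, i.e. {0,...,v-1}.
-- An edge is an (ordered representation of an) unordered pair of distinct vertices.
Edge : ℕ → Set
Edge v = Fin v × Fin v

edgeLength : (v : ℕ) → Edge v → ℕ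
edgeLength v (u , w) = ∣ toℕ u - toℕ w ∣ ⊓ (v ∸ ∣ toℕ u - toℕ w ∣)

ends : {v : ℕ} → Edge v → List (Fin v)
ends (u , w) = u ∷ w ∷ []

IsPerfectMatching : (v : ℕ) → List (Edge v) → Set
IsPerfectMatching v F = AllProper F × (concatMap ends F ↭ allFin v)
  where
  AllProper : List (Edge v) → Set
  AllProper [] = ⊤
  AllProper ((u , w) ∷ es) = (u ≢ w) × AllProper es

lengthList : (v : ℕ) → List (Edge v) → List ℕ
lengthList v F = map (edgeLength v) F

-- The list {1^{a_1}, ..., t^{a_t}}, where a (i) is a_{i+1} for i : Fin t
lengthsList : (t : ℕ) → (Fin t → ℕ) → List ℕ
lengthsList t a = concatMap (λ i → replicate (a i) (suc (toℕ i))) (allFin t)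

sizeL : (t : ℕ) → (Fin t → ℕ) → ℕ
sizeL t a = sum (map a (allFin t))

-- R = Σ_{j ≥ 1} a_{2j}   (j = toℕ i + 1 ranges over 1..t)
R-of : (t : ℕ) → (Fin t → ℕ) → ℕ
R-of t a = sum (map (λ i → evenPart (suc (toℕ i)) (a i)) (allFin t))
  where
  evenPart : ℕ → ℕ → ℕ
  evenPart j x with j % 2
  ... | zero = x
  ... | suc _ = 0

-- S = Σ_{j ≥ 2} ⌊(j-1)/2⌋ a_j  (the j = 1 term is 0 anyway)
S-of : (t : ℕ) → (Fin t → ℕ) → ℕ
S-of t a = sum (map (λ i → (toℕ i / 2) * a i) (allFin t))

-- a_j for a natural number j (a_j = 0 when j = 0 or j > t); a_j = a (j-1).
coeff : (t : ℕ) → (Fin t → ℕ) → ℕ → ℕ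
coeff t a zero = 0
coeff t a (suc k) with k <? t
... | yes k<t = a (fromℕ< k<t)
... | no _ = 0

-- Lay the vertices 0, …, 2n − 1 out as consecutive intervals, each filled by one block.
-- An odd length 2k + 1 is a chord over 2k + 2 vertices whose inner 2k vertices are
-- matched by k unit chords. Two even lengths 2k + 2 ≤ 2k′ + 2 become two crossing chords
-- over 2k′ + 4 vertices, the remaining 2k′ of which are matched by k′ unit chords; R even
-- lets all even lengths be paired this way. A block spends at most ⌊(ℓ − 1)/2⌋ unit
-- chords per length ℓ it realises, so a₁ ≥ S unit edges suffice, and the surplus ones
-- are blocks of their own. Since every length is at most t ≤ n, a chord of [0, 2n)
-- keeps its length in K_{2n}.
module Submission where

open import Defs
open import Data.Nat using (ℕ; zero; suc; _+_; _*_; _∸_; _≤_; _<_; _/_; _%_; NonZero; z≤n; s≤s)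
open import Data.Nat.Properties
  using (module ≤-Reasoning; +-suc; +-comm; +-identityʳ; *-zeroʳ; *-suc; ≤-refl; ≤-trans; ≤-total; <-irrefl
        ; +-monoʳ-≤; *-monoʳ-≤; m≤m+n; m≤n+m; m<n+m; m∸n+n≡m; ∣m-m+n∣≡n; m≤n⇒m⊓n≡m; m+n≤o⇒m≤o∸n)
open import Data.Nat.DivMod using (_mod_; m%n<n; m<n⇒m%n≡m; m/n≡1+[m∸n]/n)
open import Data.Nat.ListAction using (sum)
open import Data.Nat.ListAction.Properties using (sum-++; sum-↭)
open import Data.Nat.Tactic.RingSolver using (solve-∀)
open import Data.Fin using (Fin; toℕ) renaming (zero to fzero; suc to fsuc)
open import Data.Fin.Properties using (toℕ-fromℕ<; toℕ-injective; toℕ<n)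
open import Data.Product using (Σ; _×_; _,_; proj₁; proj₂)
open import Data.Sum using (inj₁; inj₂)
open import Data.Unit using (tt)
open import Data.List using (List; []; _∷_; [_]; _++_; map; concatMap; replicate; length; allFin; tabulate)
open import Data.List.Properties
  using (map-++; map-∘; map-cong; map-id; map-tabulate; map-replicate; map-concatMap
        ; concatMap-++; concatMap-cong; tabulate-cong; length-++; length-map; length-replicate)
open import Data.List.Relation.Unary.All using (All; []; _∷_)
open import Data.List.Relation.Unary.All.Properties using (concat⁺; tabulate⁺; replicate⁺) renaming (map⁺ to All-map⁺)
open import Data.List.Relation.Binary.Permutation.Propositional
  using (_↭_; ↭-refl; ↭-trans; ↭-reflexive; ↭-sym; prep; swap; module PermutationReasoning)
open import Data.List.Relation.Binary.Permutation.Propositional.Properties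
  using (++⁺ˡ; ++⁺ʳ; ++⁺; map⁺; ↭-length; All-resp-↭; ++-commutativeMonoid)
open import Function using (_∘_)
open import Relation.Binary.PropositionalEquality using (_≡_; _≢_; refl; sym; trans; cong; cong₂; subst; module ≡-Reasoning)
open import Algebra.Solver.CommutativeMonoid (++-commutativeMonoid {A = ℕ}) using (solve; _⊕_; _⊜_)

double : ℕ → ℕ
double zero    = 0
double (suc n) = suc (suc (double n))

double-+ : ∀ m n → double (m + n) ≡ double m + double n
double-+ zero    n = refl
double-+ (suc m) n = cong (suc ∘ suc) (double-+ m n)

double≡2* : ∀ n → double n ≡ 2 * n
double≡2* zero    = refl
double≡2* (suc n) = cong suc (trans (cong suc (double≡2* n)) (sym (+-suc n (n + 0))))

data ParityView : ℕ → Set where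
  even : ∀ k → ParityView (double k)
  odd  : ∀ k → ParityView (suc (double k))

parityView : ∀ m → ParityView m
parityView zero = even 0
parityView (suc m) with parityView m
... | even k = odd k
... | odd k  = even (suc k)

double%2≡0 : ∀ k → double k % 2 ≡ 0
double%2≡0 zero    = refl
double%2≡0 (suc k) = double%2≡0 k

1+double%2≡1 : ∀ k → suc (double k) % 2 ≡ 1
1+double%2≡1 zero    = refl
1+double%2≡1 (suc k) = 1+double%2≡1 k

double/2≡k : ∀ k → double k / 2 ≡ k
double/2≡k zero    = refl
double/2≡k (suc k) = trans (m/n≡1+[m∸n]/n {double (suc k)} (s≤s (s≤s z≤n))) (cong suc (double/2≡k k))

1+double/2≡k : ∀ k → suc (double k) / 2 ≡ k
1+double/2≡k zero    = refl
1+double/2≡k (suc k) = trans (m/n≡1+[m∸n]/n {suc (double (suc k))} (s≤s (s≤s z≤n))) (cong suc (1+double/2≡k k))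

-- Packing lengths into blocks

replicate-+ : ∀ {A : Set} m n (x : A) → replicate (m + n) x ≡ replicate m x ++ replicate n x
replicate-+ zero    n x = refl
replicate-+ (suc m) n x = cong (x ∷_) (replicate-+ m n x)

-- A list ms stands for the lengths ℓ = suc m: m % 2 is 1 exactly when ℓ is even, and
-- m / 2 = ⌊(ℓ − 1)/2⌋ is the weight of ℓ in S.
evenCount : List ℕ → ℕ
evenCount ms = sum (map (_% 2) ms)

unitsNeeded : List ℕ → ℕ
unitsNeeded ms = sum (map (_/ 2) ms)

units : ℕ → List ℕ
units c = replicate c 1

data Block : Set where
  oddChord     : ℕ → Block
  crossingPair : ℕ → ℕ → Block

blockLengths : Block → List ℕ
blockLengths (oddChord k)       = suc (double k) ∷ units k
blockLengths (crossingPair k d) = suc (suc (double (d + k))) ∷ suc (suc (double k)) ∷ units (d + k)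

record Packing (ms : List ℕ) : Set where
  field
    blocks     : List Block
    unitCount  : ℕ
    lengths↭   : concatMap blockLengths blocks ↭ units unitCount ++ map suc ms
    unitCount≤ : unitCount ≤ unitsNeeded ms

open Packing

emptyPacking : Packing []
emptyPacking = record { blocks = [] ; unitCount = 0 ; lengths↭ = ↭-refl ; unitCount≤ = z≤n }

Packing-↭ : ∀ {ms ms′} → ms ↭ ms′ → Packing ms → Packing ms′
Packing-↭ p P = record
  { blocks     = blocks P
  ; unitCount  = unitCount P
  ; lengths↭   = ↭-trans (lengths↭ P) (++⁺ˡ (units (unitCount P)) (map⁺ suc p))
  ; unitCount≤ = subst (unitCount P ≤_) (sum-↭ (map⁺ (_/ 2) p)) (unitCount≤ P)
  }

withOddChord : ∀ k {ms} → Packing ms → Packing (double k ∷ ms)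
withOddChord k {ms} P = record
  { blocks     = oddChord k ∷ blocks P
  ; unitCount  = k + U
  ; lengths↭   = ↭-trans (++⁺ˡ (blockLengths (oddChord k)) (lengths↭ P))
                 (↭-trans (solve 4 (λ x K V Y → (x ⊕ K) ⊕ (V ⊕ Y) ⊜ (K ⊕ V) ⊕ (x ⊕ Y)) ↭-refl
                            [ suc (double k) ] (units k) (units U) (map suc ms))
                   (↭-reflexive (cong (_++ _) (sym (replicate-+ k U 1)))))
  ; unitCount≤ = subst (λ h → k + U ≤ h + unitsNeeded ms) (sym (double/2≡k k)) (+-monoʳ-≤ k (unitCount≤ P))
  }
  where U = unitCount P

withCrossingPair : ∀ k d {ms} → Packing ms → Packing (suc (double (d + k)) ∷ suc (double k) ∷ ms)
withCrossingPair k d {ms} P = record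
  { blocks     = crossingPair k d ∷ blocks P
  ; unitCount  = d + k + U
  ; lengths↭   = ↭-trans (++⁺ˡ (blockLengths (crossingPair k d)) (lengths↭ P))
                 (↭-trans (solve 5 (λ x y K V Y → (x ⊕ (y ⊕ K)) ⊕ (V ⊕ Y) ⊜ (K ⊕ V) ⊕ (x ⊕ (y ⊕ Y))) ↭-refl
                            [ suc (suc (double (d + k))) ] [ suc (suc (double k)) ]
                            (units (d + k)) (units U) (map suc ms))
                   (↭-reflexive (cong (_++ _) (sym (replicate-+ (d + k) U 1)))))
  -- The weight d + k of the longer chord alone pays for the unit chords of the block.
  ; unitCount≤ = begin
      d + k + U
        ≤⟨ +-monoʳ-≤ (d + k) (≤-trans (unitCount≤ P) (m≤n+m _ k)) ⟩
      d + k + (k + unitsNeeded ms)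
        ≡⟨ cong₂ (λ p q → p + (q + unitsNeeded ms)) (1+double/2≡k (d + k)) (1+double/2≡k k) ⟨
      suc (double (d + k)) / 2 + (suc (double k) / 2 + unitsNeeded ms)
        ∎
  }
  where
  open ≤-Reasoning
  U = unitCount P

pairUp : ∀ k j {ms} → Packing ms → Packing (suc (double k) ∷ suc (double j) ∷ ms)
pairUp k j P with ≤-total j k
... | inj₁ j≤k = subst (λ i → Packing (suc (double i) ∷ _)) (m∸n+n≡m j≤k) (withCrossingPair j (k ∸ j) P)
... | inj₂ k≤j = Packing-↭ (swap _ _ ↭-refl)
                   (subst (λ i → Packing (suc (double i) ∷ _)) (m∸n+n≡m k≤j) (withCrossingPair k (j ∸ k) P))

evenCount-even : ∀ k ms → evenCount (double k ∷ ms) ≡ evenCount ms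
evenCount-even k ms = cong (_+ evenCount ms) (double%2≡0 k)

evenCount-odd : ∀ k ms → evenCount (suc (double k) ∷ ms) ≡ suc (evenCount ms)
evenCount-odd k ms = cong (_+ evenCount ms) (1+double%2≡1 k)

mutual
  pack : ∀ ms → evenCount ms % 2 ≡ 0 → Packing ms
  pack []       _  = emptyPacking
  pack (m ∷ ms) ev with parityView m
  ... | even k = withOddChord k (pack ms (subst (λ r → r % 2 ≡ 0) (evenCount-even k ms) ev))
  ... | odd k  = packPending k ms (subst (λ r → r % 2 ≡ 0) (evenCount-odd k ms) ev)

  -- The even length 2k + 2 is still waiting for a partner.
  packPending : ∀ k ms → suc (evenCount ms) % 2 ≡ 0 → Packing (suc (double k) ∷ ms)
  packPending k []       ()
  packPending k (m ∷ ms) ev with parityView m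
  ... | even j = Packing-↭ (swap _ _ ↭-refl)
                   (withOddChord j (packPending k ms (subst (λ r → suc r % 2 ≡ 0) (evenCount-even j ms) ev)))
  ... | odd j  = pairUp k j (pack ms (subst (λ r → suc r % 2 ≡ 0) (evenCount-odd j ms) ev))

-- Chords on ℕ

-- (u , ℓ) is the chord joining u and ℓ + u.
Chord : Set
Chord = ℕ × ℕ

endpoints : List Chord → List ℕ
endpoints = concatMap λ (u , ℓ) → u ∷ ℓ + u ∷ []

interval : ℕ → ℕ → List ℕ
interval x zero    = []
interval x (suc n) = x ∷ interval (suc x) n

interval-+ : ∀ x m n → interval x (m + n) ≡ interval x m ++ interval (m + x) n
interval-+ x zero    n = refl
interval-+ x (suc m) n =
  cong (x ∷_) (trans (interval-+ (suc x) m n) (cong (λ y → interval (suc x) m ++ interval y n) (+-suc m x)))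

interval-∷ʳ : ∀ x n → interval x (suc n) ≡ interval x n ++ [ n + x ]
interval-∷ʳ x n = trans (cong (interval x) (+-comm 1 n)) (interval-+ x n 1)

unitChords : ℕ → ℕ → List Chord
unitChords x zero    = []
unitChords x (suc c) = (x , 1) ∷ unitChords (suc (suc x)) c

endpoints-unitChords : ∀ x c → endpoints (unitChords x c) ≡ interval x (double c)
endpoints-unitChords x zero    = refl
endpoints-unitChords x (suc c) = cong (λ is → x ∷ suc x ∷ is) (endpoints-unitChords (suc (suc x)) c)

lengths-unitChords : ∀ x c → map proj₂ (unitChords x c) ≡ units c
lengths-unitChords x zero    = refl
lengths-unitChords x (suc c) = cong (1 ∷_) (lengths-unitChords (suc (suc x)) c)

blockSpan : Block → ℕ
blockSpan (oddChord k)       = double (suc k)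
blockSpan (crossingPair k d) = double (suc (suc (d + k)))

blockChords : ℕ → Block → List Chord
blockChords x (oddChord k)       = (x , suc (double k)) ∷ unitChords (suc x) k
blockChords x (crossingPair k d) =
  (x , suc (suc (double (d + k)))) ∷ (double d + suc x , suc (suc (double k)))
    ∷ unitChords (suc x) d ++ unitChords (suc (double d + suc x)) k

lengths-blockChords : ∀ x b → map proj₂ (blockChords x b) ≡ blockLengths b
lengths-blockChords x (oddChord k)       = cong (_ ∷_) (lengths-unitChords (suc x) k)
lengths-blockChords x (crossingPair k d) = cong (λ ℓs → _ ∷ _ ∷ ℓs) (begin
  map proj₂ (unitChords (suc x) d ++ unitChords _ k)
    ≡⟨ map-++ proj₂ (unitChords (suc x) d) _ ⟩
  map proj₂ (unitChords (suc x) d) ++ map proj₂ (unitChords _ k)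
    ≡⟨ cong₂ _++_ (lengths-unitChords _ d) (lengths-unitChords _ k) ⟩
  units d ++ units k
    ≡⟨ replicate-+ d k 1 ⟨
  units (d + k)
    ∎)
  where open ≡-Reasoning

endpoints-blockChords : ∀ x b → endpoints (blockChords x b) ↭ interval x (blockSpan b)
endpoints-blockChords x (oddChord k) = prep x (begin
  suc (double k) + x ∷ endpoints (unitChords (suc x) k)
    ≡⟨ cong₂ _∷_ (sym (+-suc (double k) x)) (endpoints-unitChords (suc x) k) ⟩
  double k + suc x ∷ interval (suc x) (double k)
    ↭⟨ solve 2 (λ y I → y ⊕ I ⊜ I ⊕ y) ↭-refl [ double k + suc x ] (interval (suc x) (double k)) ⟩
  interval (suc x) (double k) ++ [ double k + suc x ]
    ≡⟨ interval-∷ʳ (suc x) (double k) ⟨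
  interval (suc x) (suc (double k))
    ∎)
  where open PermutationReasoning
endpoints-blockChords x (crossingPair k d) = prep x (begin
  far + x ∷ b ∷ suc (suc (double k)) + b ∷ endpoints (unitChords (suc x) d ++ unitChords (suc b) k)
    ≡⟨ cong₂ (λ y z → y ∷ b ∷ z) far≡e (cong₂ _∷_ (cong suc (sym (+-suc (double k) b))) inner) ⟩
  e ∷ b ∷ suc e ∷ interval (suc x) (double d) ++ interval (suc b) (double k)
    ↭⟨ solve 5 (λ E B E′ I J → E ⊕ (B ⊕ (E′ ⊕ (I ⊕ J))) ⊜ I ⊕ (B ⊕ (J ⊕ (E ⊕ E′)))) ↭-refl
         [ e ] [ b ] [ suc e ] (interval (suc x) (double d)) (interval (suc b) (double k)) ⟩
  interval (suc x) (double d) ++ b ∷ interval (suc b) (double k) ++ e ∷ suc e ∷ []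
    ≡⟨ cong (interval (suc x) (double d) ++_) (cong (b ∷_) (interval-+ (suc b) (double k) 2)) ⟨
  interval (suc x) (double d) ++ interval b (suc (double k + 2))
    ≡⟨ interval-+ (suc x) (double d) _ ⟨
  interval (suc x) (double d + suc (double k + 2))
    ≡⟨ cong (interval (suc x)) span≡ ⟨
  interval (suc x) (suc (suc (suc (double (d + k)))))
    ∎)
  where
  open PermutationReasoning
  far = suc (suc (double (d + k)))
  b = double d + suc x
  e = double k + suc b
  far≡e : far + x ≡ e
  far≡e = trans (cong (λ y → suc (suc (y + x))) (double-+ d k))
                (shuffle (double d) (double k) x)
    where
    shuffle : ∀ p q x → suc (suc (p + q + x)) ≡ q + suc (p + suc x)
    shuffle = solve-∀
  span≡ : suc (suc (suc (double (d + k)))) ≡ double d + suc (double k + 2)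
  span≡ = trans (cong (λ y → suc (suc (suc y))) (double-+ d k))
                (shuffle (double d) (double k))
    where
    shuffle : ∀ p q → suc (suc (suc (p + q))) ≡ p + suc (q + 2)
    shuffle = solve-∀
  inner : endpoints (unitChords (suc x) d ++ unitChords (suc b) k)
          ≡ interval (suc x) (double d) ++ interval (suc b) (double k)
  inner = trans (concatMap-++ _ (unitChords (suc x) d) _)
                (cong₂ _++_ (endpoints-unitChords _ d) (endpoints-unitChords _ k))

layout : ℕ → List Block → List Chord
layout x []       = []
layout x (b ∷ bs) = blockChords x b ++ layout (blockSpan b + x) bs

layoutSpan : List Block → ℕ
layoutSpan bs = sum (map blockSpan bs)

endpoints-layout : ∀ x bs → endpoints (layout x bs) ↭ interval x (layoutSpan bs)
endpoints-layout x []       = ↭-refl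
endpoints-layout x (b ∷ bs) = begin
  endpoints (blockChords x b ++ layout (blockSpan b + x) bs)
    ≡⟨ concatMap-++ _ (blockChords x b) _ ⟩
  endpoints (blockChords x b) ++ endpoints (layout (blockSpan b + x) bs)
    ↭⟨ ++⁺ (endpoints-blockChords x b) (endpoints-layout _ bs) ⟩
  interval x (blockSpan b) ++ interval (blockSpan b + x) (layoutSpan bs)
    ≡⟨ interval-+ x (blockSpan b) _ ⟨
  interval x (layoutSpan (b ∷ bs))
    ∎
  where open PermutationReasoning

lengths-layout : ∀ x bs → map proj₂ (layout x bs) ≡ concatMap blockLengths bs
lengths-layout x []       = refl
lengths-layout x (b ∷ bs) = trans (map-++ proj₂ (blockChords x b) _)
                                  (cong₂ _++_ (lengths-blockChords x b) (lengths-layout _ bs))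

length-endpoints : ∀ E → length (endpoints E) ≡ double (length E)
length-endpoints []      = refl
length-endpoints (_ ∷ E) = cong (suc ∘ suc) (length-endpoints E)

length-interval : ∀ x n → length (interval x n) ≡ n
length-interval x zero    = refl
length-interval x (suc n) = cong suc (length-interval (suc x) n)

span≡double-length : ∀ {x s} E → endpoints E ↭ interval x s → s ≡ double (length E)
span≡double-length {x} {s} E p =
  trans (sym (length-interval x s)) (trans (sym (↭-length p)) (length-endpoints E))

lengths-unitBlocks : ∀ r → concatMap blockLengths (replicate r (oddChord 0)) ≡ units r
lengths-unitBlocks zero    = refl
lengths-unitBlocks (suc r) = cong (1 ∷_) (lengths-unitBlocks r)

padTo : ∀ {ms} → ℕ → Packing ms → List Block
padTo c P = blocks P ++ replicate (c ∸ unitCount P) (oddChord 0)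

lengths-padTo : ∀ {ms} (P : Packing ms) {c} → unitCount P ≤ c →
  concatMap blockLengths (padTo c P) ↭ units c ++ map suc ms
lengths-padTo {ms} P {c} U≤c = begin
  concatMap blockLengths (blocks P ++ replicate r (oddChord 0))
    ≡⟨ trans (concatMap-++ blockLengths (blocks P) _) (cong (_ ++_) (lengths-unitBlocks r)) ⟩
  concatMap blockLengths (blocks P) ++ units r
    ↭⟨ ++⁺ʳ (units r) (lengths↭ P) ⟩
  (units U ++ map suc ms) ++ units r
    ↭⟨ solve 3 (λ V Y R → (V ⊕ Y) ⊕ R ⊜ (R ⊕ V) ⊕ Y) ↭-refl (units U) (map suc ms) (units r) ⟩
  (units r ++ units U) ++ map suc ms
    ≡⟨ cong (λ u → u ++ map suc ms) (trans (sym (replicate-+ r U 1)) (cong units (m∸n+n≡m U≤c))) ⟩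
  units c ++ map suc ms
    ∎
  where
  open PermutationReasoning
  U = unitCount P
  r = c ∸ U

intervalMatching : ∀ c ms → evenCount ms % 2 ≡ 0 → unitsNeeded ms ≤ c →
  Σ (List Chord) λ E → endpoints E ↭ interval 0 (double (length E)) × map proj₂ E ↭ units c ++ map suc ms
intervalMatching c ms ev needed≤c = E , endpoints↭ , lengths↭′
  where
  P = pack ms ev
  bs = padTo c P
  E = layout 0 bs
  endpoints↭ : endpoints E ↭ interval 0 (double (length E))
  endpoints↭ = subst (λ s → endpoints E ↭ interval 0 s) (span≡double-length E (endpoints-layout 0 bs))
                     (endpoints-layout 0 bs)
  lengths↭′ : map proj₂ E ↭ units c ++ map suc ms
  lengths↭′ = ↭-trans (↭-reflexive (lengths-layout 0 bs)) (lengths-padTo P (≤-trans (unitCount≤ P) needed≤c))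

-- From chords on ℕ to matchings of K_v

toEdge : ∀ v .{{_ : NonZero v}} → Chord → Edge v
toEdge v (u , ℓ) = u mod v , (ℓ + u) mod v

toℕ-mod : ∀ {u v} .{{_ : NonZero v}} → u < v → toℕ (u mod v) ≡ u
toℕ-mod {u} {v} u<v = trans (toℕ-fromℕ< (m%n<n u v)) (m<n⇒m%n≡m u<v)

interval-< : ∀ {b} x n → x + n ≤ b → All (_< b) (interval x n)
interval-< x zero    _ = []
interval-< {b} x (suc n) x+n<b = ≤-trans (s≤s (m≤m+n x n)) x+n<b′ ∷ interval-< (suc x) n x+n<b′
  where
  x+n<b′ : suc x + n ≤ b
  x+n<b′ = subst (_≤ b) (+-suc x n) x+n<b

tabulate-interval : ∀ x n → tabulate (λ (i : Fin n) → x + toℕ i) ≡ interval x n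
tabulate-interval x zero    = refl
tabulate-interval x (suc n) =
  cong₂ _∷_ (+-identityʳ x) (trans (tabulate-cong (λ i → +-suc x (toℕ i))) (tabulate-interval (suc x) n))

map-toℕ-allFin : ∀ n → map toℕ (allFin n) ≡ interval 0 n
map-toℕ-allFin n = trans (map-tabulate (λ i → i) toℕ) (tabulate-interval 0 n)

map-mod-interval : ∀ v .{{_ : NonZero v}} → map (_mod v) (interval 0 v) ≡ allFin v
map-mod-interval v = begin
  map (_mod v) (interval 0 v)          ≡⟨ cong (map (_mod v)) (map-toℕ-allFin v) ⟨
  map (_mod v) (map toℕ (allFin v))    ≡⟨ map-∘ (allFin v) ⟨
  map (λ i → toℕ i mod v) (allFin v)   ≡⟨ map-cong (λ i → toℕ-injective (toℕ-mod (toℕ<n i))) (allFin v) ⟩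
  map (λ i → i) (allFin v)             ≡⟨ map-id (allFin v) ⟩
  allFin v                             ∎
  where open ≡-Reasoning

ends-toEdges : ∀ v .{{_ : NonZero v}} E → concatMap ends (map (toEdge v) E) ≡ map (_mod v) (endpoints E)
ends-toEdges v []            = refl
ends-toEdges v ((u , ℓ) ∷ E) = cong (λ ws → u mod v ∷ (ℓ + u) mod v ∷ ws) (ends-toEdges v E)

Fits : ℕ → ℕ → Set
Fits v ℓ = 1 ≤ ℓ × 2 * ℓ ≤ v

endpoints<v : ∀ {v} E → endpoints E ↭ interval 0 v → All (_< v) (endpoints E)
endpoints<v {v} E ends↭ = All-resp-↭ (↭-sym ends↭) (interval-< 0 v ≤-refl)

lengthList-toEdges : ∀ v .{{_ : NonZero v}} E → All (Fits v) (map proj₂ E) → endpoints E ↭ interval 0 v →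
  lengthList v (map (toEdge v) E) ≡ map proj₂ E
lengthList-toEdges v E fits ends↭ = go E fits (endpoints<v E ends↭)
  where
  go : ∀ E → All (Fits v) (map proj₂ E) → All (_< v) (endpoints E) → lengthList v (map (toEdge v) E) ≡ map proj₂ E
  go []            []                  []                    = refl
  go ((u , ℓ) ∷ E) ((_ , 2ℓ≤v) ∷ fits) (u<v ∷ w<v ∷ ends<v) = cong₂ _∷_ edgeLength≡ℓ (go E fits ends<v)
    where
    edgeLength≡ℓ : edgeLength v (toEdge v (u , ℓ)) ≡ ℓ
    edgeLength≡ℓ rewrite toℕ-mod u<v | toℕ-mod w<v | +-comm ℓ u | ∣m-m+n∣≡n u ℓ =
      m≤n⇒m⊓n≡m (m+n≤o⇒m≤o∸n ℓ (subst (_≤ v) (cong (ℓ +_) (+-identityʳ ℓ)) 2ℓ≤v))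

mutual
  toEdges-perfect : ∀ v .{{_ : NonZero v}} E → All (Fits v) (map proj₂ E) → endpoints E ↭ interval 0 v →
    IsPerfectMatching v (map (toEdge v) E)
  toEdges-perfect v E fits ends↭ =
    toEdges-proper v E fits (endpoints<v E ends↭) ,
    ↭-trans (↭-reflexive (ends-toEdges v E))
            (subst (map (_mod v) (endpoints E) ↭_) (map-mod-interval v) (map⁺ (_mod v) ends↭))

  -- The hole is the predicate local to IsPerfectMatching, which has no name outside Defs;
  -- it is inferred from the use above.
  toEdges-proper : ∀ v .{{_ : NonZero v}} E → All (Fits v) (map proj₂ E) → All (_< v) (endpoints E) → _
  toEdges-proper v []            []                  []                    = tt
  toEdges-proper v ((u , ℓ) ∷ E) ((1≤ℓ , _) ∷ fits) (u<v ∷ w<v ∷ ends<v) = distinct , toEdges-proper v E fits ends<v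
    where
    distinct : u mod v ≢ (ℓ + u) mod v
    distinct eq = <-irrefl (trans (sym (toℕ-mod u<v)) (trans (cong toℕ eq) (toℕ-mod w<v))) (m<n+m u 1≤ℓ)

-- The quantities of the statement

mutual
  R-of≡ : ∀ t a → R-of t a ≡ sum (map (λ i → toℕ i % 2 * a i) (allFin t))
  R-of≡ t a = cong sum (map-cong (R-of-summand t a) (allFin t))

  -- The hole is the summand of R-of, built from a function local to Defs that cannot be named here.
  R-of-summand : ∀ t (a : Fin t → ℕ) i → _ ≡ toℕ i % 2 * a i
  R-of-summand t a i with toℕ i | parityView (toℕ i)
  ... | .(double k)       | even k rewrite 1+double%2≡1 k | double%2≡0 k = refl
  ... | .(suc (double k)) | odd k  rewrite double%2≡0 (suc k) | 1+double%2≡1 k = sym (+-identityʳ (a i))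

reducedLengths : ∀ {t} → (Fin t → ℕ) → List (Fin t) → List ℕ
reducedLengths a = concatMap (λ i → replicate (a i) (toℕ i))

length-concatMap-replicate : ∀ {I A : Set} (c : I → ℕ) (f : I → A) xs →
  length (concatMap (λ i → replicate (c i) (f i)) xs) ≡ sum (map c xs)
length-concatMap-replicate c f []       = refl
length-concatMap-replicate c f (i ∷ xs) =
  trans (length-++ (replicate (c i) (f i))) (cong₂ _+_ (length-replicate (c i)) (length-concatMap-replicate c f xs))

sum-map-replicate : ∀ (g : ℕ → ℕ) c m → sum (map g (replicate c m)) ≡ g m * c
sum-map-replicate g zero    m = sym (*-zeroʳ (g m))
sum-map-replicate g (suc c) m = trans (cong (g m +_) (sum-map-replicate g c m)) (sym (*-suc (g m) c))

sum-map-concatMap-replicate : ∀ {I : Set} (g : ℕ → ℕ) (c : I → ℕ) (f : I → ℕ) xs →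
  sum (map g (concatMap (λ i → replicate (c i) (f i)) xs)) ≡ sum (map (λ i → g (f i) * c i) xs)
sum-map-concatMap-replicate g c f []       = refl
sum-map-concatMap-replicate g c f (i ∷ xs) = begin
  sum (map g (replicate (c i) (f i) ++ rest))             ≡⟨ cong sum (map-++ g (replicate (c i) (f i)) rest) ⟩
  sum (map g (replicate (c i) (f i)) ++ map g rest)       ≡⟨ sum-++ (map g (replicate (c i) (f i))) _ ⟩
  sum (map g (replicate (c i) (f i))) + sum (map g rest)  ≡⟨ cong₂ _+_ (sum-map-replicate g (c i) (f i))
                                                                       (sum-map-concatMap-replicate g c f xs) ⟩
  g (f i) * c i + sum (map (λ j → g (f j) * c j) xs)      ∎
  where
  open ≡-Reasoning
  rest = concatMap (λ j → replicate (c j) (f j)) xs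

lengthsList-suc : ∀ {t} (a : Fin (suc t) → ℕ) →
  lengthsList (suc t) a ≡ units (a fzero) ++ map suc (reducedLengths a (tabulate fsuc))
lengthsList-suc a = cong (units (a fzero) ++_) (sym
  (trans (map-concatMap suc (λ i → replicate (a i) (toℕ i)) (tabulate fsuc))
         (concatMap-cong (λ i → map-replicate suc (a i) (toℕ i)) (tabulate fsuc))))

S-of-suc : ∀ {t} (a : Fin (suc t) → ℕ) → S-of (suc t) a ≡ unitsNeeded (reducedLengths a (tabulate fsuc))
S-of-suc a = sym (sum-map-concatMap-replicate (_/ 2) a toℕ (tabulate fsuc))

R-of-suc : ∀ {t} (a : Fin (suc t) → ℕ) → R-of (suc t) a ≡ evenCount (reducedLengths a (tabulate fsuc))
R-of-suc {t} a = trans (R-of≡ (suc t) a) (sym (sum-map-concatMap-replicate (_% 2) a toℕ (tabulate fsuc)))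

lengthsList-fits : ∀ {t n} (a : Fin t → ℕ) → t ≤ n → All (Fits (2 * n)) (lengthsList t a)
lengthsList-fits a t≤n =
  concat⁺ (All-map⁺ (tabulate⁺ λ i → replicate⁺ (a i) (s≤s z≤n , *-monoʳ-≤ 2 (≤-trans (toℕ<n i) t≤n))))

proposition2p11 : (t n : ℕ) → 1 ≤ t → t ≤ n → (a : Fin t → ℕ)
    → sizeL t a ≡ n
    → R-of t a % 2 ≡ 0
    → S-of t a ≤ coeff t a 1
    → Σ (List (Edge (2 * n))) (λ F →
        IsPerfectMatching (2 * n) F × (lengthList (2 * n) F ↭ lengthsList t a))
proposition2p11 (suc t) zero    _ () a
-- Matching n as suc m provides the instance NonZero (2 * n) that toEdge needs.
proposition2p11 (suc t) (suc m) _ t≤n a |L|≡n R-even S≤a₁ =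
  map (toEdge (2 * n)) E ,
  toEdges-perfect _ E fits endpoints↭ ,
  ↭-trans (↭-reflexive (lengthList-toEdges _ E fits endpoints↭)) E↭L
  where
  n = suc m
  ms = reducedLengths a (tabulate fsuc)
  matching = intervalMatching (a fzero) ms (subst (λ r → r % 2 ≡ 0) (R-of-suc a) R-even)
                                          (subst (_≤ a fzero) (S-of-suc a) S≤a₁)
  E = proj₁ matching
  E↭L : map proj₂ E ↭ lengthsList (suc t) a
  E↭L = subst (map proj₂ E ↭_) (sym (lengthsList-suc a)) (proj₂ (proj₂ matching))
  |E|≡n : length E ≡ n
  |E|≡n = begin
    length E                       ≡⟨ length-map proj₂ E ⟨
    length (map proj₂ E)           ≡⟨ ↭-length E↭L ⟩
    length (lengthsList (suc t) a) ≡⟨ length-concatMap-replicate a _ (allFin (suc t)) ⟩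
    sizeL (suc t) a                ≡⟨ |L|≡n ⟩
    n                              ∎
    where open ≡-Reasoning
  endpoints↭ : endpoints E ↭ interval 0 (2 * n)
  endpoints↭ = subst (λ s → endpoints E ↭ interval 0 s) (trans (cong double |E|≡n) (double≡2* n))
                     (proj₁ (proj₂ matching))
  fits : All (Fits (2 * n)) (map proj₂ E)
  fits = All-resp-↭ (↭-sym E↭L) (lengthsList-fits a t≤n)
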